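{- For every positive integer $n$, $$S_n^{B,+}-S_n^{B,- }=\begin{cases}1& n\equiv 0,1\pmod 4,\\ -1& n\equiv 2,3\pmod 4.\end{cases}$$
   Context: $\mathfrak{B}_n$ is the group of signed permutations in window notation $\pi=\pi_1\cdots\pi_n$ ($\pi_i\in\{\pm1,\dots,\pm n\}$, $\{|\pi_i|\}=[n]$), with $\mathrm{inv}_B(\pi)=|\{i<j:\pi_i>\pi_j\}|+|\{i<j:-\pi_i>\pi_j\}|+|\{i:\pi_i<0\}|$. A snake of type B is $\pi\in\mathfrak{B}_n$ with $0<\pi_1>\pi_2<\pi_3>\pi_4<\cdots$ (usual order on $\mathbb{Z}$). $S_n^{B,+}$ (resp. $S_n^{B,- }$) is the number of snakes in $\mathfrak{B}_n$ with $\mathrm{inv}_B(\pi)$ even (resp. odd). -}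

module Defs where

open import Data.Bool using (Bool; true; false; _∧_; if_then_else_; not)
open import Data.Nat as ℕ using (ℕ; zero; suc)
open import Data.Integer as ℤ using (ℤ; +_; -_; ∣_∣)
open import Data.List using (List; []; _∷_; map; concatMap; filter; length)
open import Data.List using (upTo)
import Data.Bool
open import Relation.Nullary.Decidable using (⌊_⌋)

_<ᵇ_ : ℤ → ℤ → Bool
x <ᵇ y = ⌊ x ℤ.<? y ⌋

allᵇ : {A : Set} → (A → Bool) → List A → Bool
allᵇ p [] = true
allᵇ p (x ∷ xs) = p x ∧ allᵇ p xs

countᵇ : {A : Set} → (A → Bool) → List A → ℕ
countᵇ p [] = 0
countᵇ p (x ∷ xs) = if p x then suc (countᵇ p xs) else countᵇ p xs

oneTo : ℕ → List ℕ
oneTo n = map suc (upTo n)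

letters : ℕ → List ℤ
letters n = concatMap (λ k → (+ k) ∷ (- (+ k)) ∷ []) (oneTo n)

words : ℕ → List ℤ → List (List ℤ)
words zero A = [] ∷ []
words (suc k) A = concatMap (λ a → map (a ∷_) (words k A)) A

-- window notation π₁⋯πₙ is a signed permutation of [n]:
-- {|π_i|} = [n], i.e. each k ∈ [n] occurs exactly once as an absolute value
isSignedPerm : ℕ → List ℤ → Bool
isSignedPerm n w = allᵇ (λ k → ⌊ countᵇ (λ x → ⌊ ∣ x ∣ ℕ.≟ k ⌋) w ℕ.≟ 1 ⌋) (oneTo n)

signedPerms : ℕ → List (List ℤ)
signedPerms n = filter (λ w → isSignedPerm n w Data.Bool.≟ true) (words n (letters n))

-- inv_B(π) = #{i<j : πᵢ > πⱼ} + #{i<j : -πᵢ > πⱼ} + #{i : πᵢ < 0}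
invB : List ℤ → ℕ
invB [] = 0
invB (x ∷ xs) =
  countᵇ (λ y → y <ᵇ x) xs ℕ.+ countᵇ (λ y → y <ᵇ (- x)) xs
  ℕ.+ (if x <ᵇ (+ 0) then 1 else 0) ℕ.+ invB xs

mutual
  altDown : List ℤ → Bool
  altDown (x ∷ y ∷ r) = (y <ᵇ x) ∧ altUp (y ∷ r)
  altDown _ = true

  altUp : List ℤ → Bool
  altUp (x ∷ y ∷ r) = (x <ᵇ y) ∧ altDown (y ∷ r)
  altUp _ = true

isSnakeB : List ℤ → Bool
isSnakeB [] = true
isSnakeB (x ∷ xs) = ((+ 0) <ᵇ x) ∧ altDown (x ∷ xs)

isEven : ℕ → Bool
isEven zero = true
isEven (suc n) = not (isEven n)

SB⁺ : ℕ → ℕ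
SB⁺ n = countᵇ (λ w → isSnakeB w ∧ isEven (invB w)) (signedPerms n)

SB⁻ : ℕ → ℕ
SB⁻ n = countᵇ (λ w → isSnakeB w ∧ not (isEven (invB w))) (signedPerms n)

-- Write S⁺ − S⁻ as the sum of (−1)^inv_B over all snakes and group the snakes by their longest prefix of
-- the form 1, −2, 3, −4, …, ±k. Suppose such a prefix is followed by a letter a with |a| ≠ k + 1. The
-- remaining letters all have absolute value ≥ k + 1, so switching the sign of the letter ±(k + 1) changes
-- no comparison between neighbours but flips the parity of inv_B: these snakes cancel in pairs. If
-- |a| = k + 1, only one of the two signs continues the alternation. Hence the sum collapses onto the single
-- snake 1, −2, 3, …, ±n, whose inv_B has the parity of its ⌊n/2⌋ negative entries, and (−1)^⌊n/2⌋ = 1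
-- exactly when n ≡ 0, 1 (mod 4).

module Submission where

open import Defs
open import Data.Nat using (ℕ; _≥_; _%_)
open import Data.Integer using (ℤ; +_; -_; _-_)
open import Relation.Binary.PropositionalEquality using (_≡_)
open import Data.Sum using (_⊎_)
open import Data.Product using (_×_)

open import Data.Bool using (Bool; true; false; not; _∧_; _xor_; if_then_else_)
import Data.Bool as Bool
import Data.Bool.Properties as BoolP
open import Data.Bool.Solver using (module xor-∧-Solver)
open import Data.Nat as ℕ using (zero; suc; _≤_; _<_; z≤n; s≤s; ⌊_/2⌋)
import Data.Nat.Properties as ℕP
open import Data.Nat.DivMod using ([m+n]%n≡m%n)
open import Data.Integer as ℤ using (_+_; ∣_∣; -[1+_]; 0ℤ; 1ℤ; -1ℤ; +<+; -<+; -<-)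
import Data.Integer.Properties as ℤP
open import Data.Integer.Tactic.RingSolver using (solve-∀)
open import Data.List using (List; []; _∷_; map; concatMap; filter; _++_)
import Data.List.Properties as ListP
open import Data.List.Relation.Unary.All as All using (All; []; _∷_)
import Data.List.Relation.Unary.All.Properties as AllP
open import Data.List.Relation.Unary.Unique.Propositional using (Unique)
open import Data.List.Relation.Unary.AllPairs using (_∷_)
import Data.List.Relation.Unary.Unique.Propositional.Properties as UniqueP
open import Data.List.Membership.Propositional using (_∈_)
open import Data.List.Membership.Propositional.Properties using (∈-map⁺; ∈-map⁻; ∈-upTo⁺; ∈-upTo⁻)
open import Data.List.Relation.Unary.Any using (here; there)
open import Data.Product using (_,_; proj₁; proj₂; swap)
open import Data.Sum using (inj₁; inj₂)
open import Data.Empty using (⊥-elim)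
open import Function using (_∘_)
open import Relation.Binary.PropositionalEquality
  using (_≢_; refl; sym; trans; cong; cong₂; subst; module ≡-Reasoning)
open import Relation.Nullary using (¬_; Dec; yes; no)
open import Relation.Nullary.Decidable using (⌊_⌋; toWitness; fromWitness)
open import Function.Bundles using (Equivalence)
open import Relation.Binary.Definitions using (tri<; tri≈; tri>)

private variable
  A B : Set

∑ : List A → (A → ℤ) → ℤ
∑ []       f = 0ℤ
∑ (x ∷ xs) f = f x + ∑ xs f

∑-++ : ∀ (xs ys : List A) f → ∑ (xs ++ ys) f ≡ ∑ xs f + ∑ ys f
∑-++ []       ys f = sym (ℤP.+-identityˡ _)
∑-++ (x ∷ xs) ys f = trans (cong (_+_ (f x)) (∑-++ xs ys f)) (sym (ℤP.+-assoc (f x) _ _))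

∑-map : (g : A → B) (xs : List A) (f : B → ℤ) → ∑ (map g xs) f ≡ ∑ xs (f ∘ g)
∑-map g []       f = refl
∑-map g (x ∷ xs) f = cong (_+_ (f (g x))) (∑-map g xs f)

∑-concatMap : (h : A → List B) (xs : List A) (f : B → ℤ) →
              ∑ (concatMap h xs) f ≡ ∑ xs (λ x → ∑ (h x) f)
∑-concatMap h []       f = refl
∑-concatMap h (x ∷ xs) f =
  trans (∑-++ (h x) (concatMap h xs) f) (cong (_+_ (∑ (h x) f)) (∑-concatMap h xs f))

∑-cong-All : {P : A → Set} {f g : A → ℤ} (xs : List A) → All P xs →
             (∀ x → P x → f x ≡ g x) → ∑ xs f ≡ ∑ xs g
∑-cong-All []       []         f≗g = refl
∑-cong-All (x ∷ xs) (px ∷ pxs) f≗g = cong₂ _+_ (f≗g x px) (∑-cong-All xs pxs f≗g)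

∑-cong : {f g : A → ℤ} (xs : List A) → (∀ x → f x ≡ g x) → ∑ xs f ≡ ∑ xs g
∑-cong []       f≗g = refl
∑-cong (x ∷ xs) f≗g = cong₂ _+_ (f≗g x) (∑-cong xs f≗g)

∑-neg : ∀ (xs : List A) f → ∑ xs (λ x → - f x) ≡ - ∑ xs f
∑-neg []       f = refl
∑-neg (x ∷ xs) f = trans (cong (_+_ (- f x)) (∑-neg xs f)) (sym (ℤP.neg-distrib-+ (f x) _))

∑-zero : ∀ (xs : List A) → ∑ xs (λ _ → 0ℤ) ≡ 0ℤ
∑-zero []       = refl
∑-zero (x ∷ xs) = trans (ℤP.+-identityˡ _) (∑-zero xs)

∑-indicator : ∀ {xs m} (T : ℕ → ℤ) → Unique xs → m ∈ xs →
              ∑ xs (λ k → if ⌊ k ℕ.≟ m ⌋ then T k else 0ℤ) ≡ T m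
∑-indicator {x ∷ xs} {m} T (x∉xs ∷ unique) m∈x∷xs with x ℕ.≟ m | m∈x∷xs
... | yes refl | _ = trans (cong (_+_ (T x)) rest-vanishes) (ℤP.+-identityʳ (T x))
  where
  rest-vanishes : ∑ xs (λ k → if ⌊ k ℕ.≟ x ⌋ then T k else 0ℤ) ≡ 0ℤ
  rest-vanishes = trans (∑-cong-All xs x∉xs vanish) (∑-zero xs)
    where
    vanish : ∀ k → x ≢ k → (if ⌊ k ℕ.≟ x ⌋ then T k else 0ℤ) ≡ 0ℤ
    vanish k x≢k with k ℕ.≟ x
    ... | yes k≡x = ⊥-elim (x≢k (sym k≡x))
    ... | no  _   = refl
... | no x≢m | here m≡x   = ⊥-elim (x≢m (sym m≡x))
... | no _   | there m∈xs = trans (ℤP.+-identityˡ _) (∑-indicator T unique m∈xs)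

self-neg⇒0 : ∀ t → t ≡ - t → t ≡ 0ℤ
self-neg⇒0 (+ zero)  _  = refl
self-neg⇒0 (+ suc n) ()
self-neg⇒0 -[1+ n ]  ()

sign : Bool → ℤ
sign true  = 1ℤ
sign false = -1ℤ

countᵇ-cong : {p q : A → Bool} (xs : List A) → (∀ x → p x ≡ q x) → countᵇ p xs ≡ countᵇ q xs
countᵇ-cong             []       p≗q = refl
countᵇ-cong {p = p} {q} (x ∷ xs) p≗q rewrite p≗q x with q x
... | true  = cong suc (countᵇ-cong xs p≗q)
... | false = countᵇ-cong xs p≗q

countᵇ-filter : ∀ (p q : A → Bool) xs →
                countᵇ q (filter (λ x → p x Bool.≟ true) xs) ≡ countᵇ (λ x → p x ∧ q x) xs
countᵇ-filter p q []       = refl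
countᵇ-filter p q (x ∷ xs) with p x
... | true  = cong (λ c → if q x then suc c else c) (countᵇ-filter p q xs)
... | false = countᵇ-filter p q xs

countᵇ-++ : ∀ (p : A → Bool) xs ys → countᵇ p (xs ++ ys) ≡ countᵇ p xs ℕ.+ countᵇ p ys
countᵇ-++ p []       ys = refl
countᵇ-++ p (x ∷ xs) ys with p x
... | true  = cong suc (countᵇ-++ p xs ys)
... | false = countᵇ-++ p xs ys

countᵇ-signed-difference : ∀ (c e : A → Bool) xs →
  + countᵇ (λ x → c x ∧ e x) xs - + countᵇ (λ x → c x ∧ not (e x)) xs
    ≡ ∑ xs (λ x → if c x then sign (e x) else 0ℤ)
countᵇ-signed-difference c e []       = refl
countᵇ-signed-difference c e (x ∷ xs) = extend (c x) (e x) (countᵇ-signed-difference c e xs)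
  where
  extend : ∀ cx ex {a b t} → + a - + b ≡ t →
           + (if cx ∧ ex then suc a else a) - + (if cx ∧ not ex then suc b else b)
             ≡ (if cx then sign ex else 0ℤ) + t
  extend false _             refl = sym (ℤP.+-identityˡ _)
  extend true  true  {a} {b} refl = ℤP.+-assoc 1ℤ (+ a) (- + b)
  extend true  false {a} {b} refl = minus-suc (+ a) (+ b)
    where
    minus-suc : ∀ i j → i - (1ℤ + j) ≡ -1ℤ + (i - j)
    minus-suc = solve-∀

snakeWeight : ℕ → List ℤ → ℤ
snakeWeight n w = if isSignedPerm n w ∧ isSnakeB w then sign (isEven (invB w)) else 0ℤ

signedSnakeCount : ∀ n → + SB⁺ n - + SB⁻ n ≡ ∑ (words n (letters n)) (snakeWeight n)
signedSnakeCount n = begin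
  + SB⁺ n - + SB⁻ n
    ≡⟨ cong₂ (λ a b → + a - + b) (unfilter even) (unfilter (not ∘ even)) ⟩
  + countᵇ (λ w → perm∧snake w ∧ even w) W - + countᵇ (λ w → perm∧snake w ∧ not (even w)) W
    ≡⟨ countᵇ-signed-difference perm∧snake even W ⟩
  ∑ W (snakeWeight n) ∎
  where
  open ≡-Reasoning
  W = words n (letters n)
  even perm∧snake : List ℤ → Bool
  even w       = isEven (invB w)
  perm∧snake w = isSignedPerm n w ∧ isSnakeB w
  unfilter : ∀ e → countᵇ (λ w → isSnakeB w ∧ e w) (signedPerms n)
                      ≡ countᵇ (λ w → perm∧snake w ∧ e w) W
  unfilter e = trans (countᵇ-filter (isSignedPerm n) _ W)
                     (countᵇ-cong W (λ w → sym (BoolP.∧-assoc (isSignedPerm n w) (isSnakeB w) (e w))))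

∑-words-suc : ∀ (L : List ℤ) r (g : List ℤ → ℤ) →
              ∑ (words (suc r) L) g ≡ ∑ L (λ a → ∑ (words r L) (λ v → g (a ∷ v)))
∑-words-suc L r g = trans (∑-concatMap (λ a → map (a ∷_) (words r L)) L g)
                          (∑-cong L (λ a → ∑-map (a ∷_) (words r L) g))

∑-words-cong-All : ∀ {P : ℤ → Set} {g g′ : List ℤ → ℤ} (L : List ℤ) r → All P L →
                   (∀ w → All P w → g w ≡ g′ w) → ∑ (words r L) g ≡ ∑ (words r L) g′
∑-words-cong-All L zero    pL g≗g′ = cong (λ t → t + 0ℤ) (g≗g′ [] [])
∑-words-cong-All {g = g} {g′} L (suc r) pL g≗g′ = begin
  ∑ (words (suc r) L) g
    ≡⟨ ∑-words-suc L r g ⟩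
  ∑ L (λ a → ∑ (words r L) (λ v → g (a ∷ v)))
    ≡⟨ ∑-cong-All L pL (λ a pa → ∑-words-cong-All L r pL (λ v pv → g≗g′ (a ∷ v) (pa ∷ pv))) ⟩
  ∑ L (λ a → ∑ (words r L) (λ v → g′ (a ∷ v)))
    ≡⟨ sym (∑-words-suc L r g′) ⟩
  ∑ (words (suc r) L) g′ ∎
  where open ≡-Reasoning

∑-words-map : ∀ (L : List ℤ) (f : ℤ → ℤ) → (∀ h → ∑ L (h ∘ f) ≡ ∑ L h) →
              ∀ r (g : List ℤ → ℤ) → ∑ (words r L) (g ∘ map f) ≡ ∑ (words r L) g
∑-words-map L f f-invariant zero    g = refl
∑-words-map L f f-invariant (suc r) g = begin
  ∑ (words (suc r) L) (g ∘ map f)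
    ≡⟨ ∑-words-suc L r (g ∘ map f) ⟩
  ∑ L (λ a → ∑ (words r L) (λ v → g (f a ∷ map f v)))
    ≡⟨ ∑-cong L (λ a → ∑-words-map L f f-invariant r (λ v → g (f a ∷ v))) ⟩
  ∑ L (λ a → ∑ (words r L) (λ v → g (f a ∷ v)))
    ≡⟨ f-invariant (λ b → ∑ (words r L) (λ v → g (b ∷ v))) ⟩
  ∑ L (λ b → ∑ (words r L) (λ v → g (b ∷ v)))
    ≡⟨ sym (∑-words-suc L r g) ⟩
  ∑ (words (suc r) L) g ∎
  where open ≡-Reasoning

<ᵇ-true : ∀ {x y} → x ℤ.< y → (x <ᵇ y) ≡ true
<ᵇ-true {x} {y} x<y with x ℤ.<? y
... | yes _   = refl
... | no  x≮y = ⊥-elim (x≮y x<y)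

<ᵇ-false : ∀ {x y} → ¬ x ℤ.< y → (x <ᵇ y) ≡ false
<ᵇ-false {x} {y} x≮y with x ℤ.<? y
... | yes x<y = ⊥-elim (x≮y x<y)
... | no  _   = refl

<ᵇ-flip : ∀ x y → x ≢ y → (y <ᵇ x) ≡ not (x <ᵇ y)
<ᵇ-flip x y x≢y with ℤP.<-cmp x y
... | tri< x<y _ y≮x = trans (<ᵇ-false y≮x) (cong not (sym (<ᵇ-true x<y)))
... | tri≈ _ x≡y _   = ⊥-elim (x≢y x≡y)
... | tri> x≮y _ y<x = trans (<ᵇ-true y<x) (cong not (sym (<ᵇ-false x≮y)))

<ᵇ-neg : ∀ x y → ((- y) <ᵇ (- x)) ≡ (x <ᵇ y)
<ᵇ-neg x y with x ℤ.<? y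
... | yes x<y = <ᵇ-true (ℤP.neg-mono-< x<y)
... | no  x≮y = <ᵇ-false (x≮y ∘ ℤP.neg-cancel-<)

-[1+]-≮ : ∀ {i j} → suc i < suc j → ¬ (-[1+ i ] ℤ.< -[1+ j ])
-[1+]-≮ i<j (-<- j<i) = ℕP.<-asym j<i (ℕP.≤-pred i<j)

<ᵇ-negˡ : ∀ a b → ∣ a ∣ < ∣ b ∣ → ((- a) <ᵇ b) ≡ (a <ᵇ b)
<ᵇ-negˡ (+ zero)  b        _   = refl
<ᵇ-negˡ (+ suc i) (+ j)    i<j = trans (<ᵇ-true { -[1+ i ]} {+ j} -<+) (sym (<ᵇ-true (+<+ i<j)))
<ᵇ-negˡ (+ suc i) -[1+ j ] i<j = trans (<ᵇ-false (-[1+]-≮ i<j)) (sym (<ᵇ-false {+ suc i} { -[1+ j ]} λ ()))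
<ᵇ-negˡ -[1+ i ]  (+ j)    i<j = trans (<ᵇ-true (+<+ i<j)) (sym (<ᵇ-true { -[1+ i ]} {+ j} -<+))
<ᵇ-negˡ -[1+ i ]  -[1+ j ] i<j = trans (<ᵇ-false {+ suc i} { -[1+ j ]} λ ()) (sym (<ᵇ-false (-[1+]-≮ i<j)))

<ᵇ-negʳ : ∀ a b → ∣ b ∣ < ∣ a ∣ → (a <ᵇ (- b)) ≡ (a <ᵇ b)
<ᵇ-negʳ a b b<a = begin
  a <ᵇ (- b)       ≡⟨ sym (<ᵇ-neg a (- b)) ⟩
  (- - b) <ᵇ (- a) ≡⟨ cong (_<ᵇ (- a)) (ℤP.neg-involutive b) ⟩
  b <ᵇ (- a)       ≡⟨ sym (<ᵇ-negˡ b (- a) (subst (∣ b ∣ <_) (sym (ℤP.∣-i∣≡∣i∣ a)) b<a)) ⟩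
  (- b) <ᵇ (- a)   ≡⟨ <ᵇ-neg a b ⟩
  a <ᵇ b           ∎
  where open ≡-Reasoning

toggle : ℕ → ℤ → ℤ
toggle m y = if ⌊ ∣ y ∣ ℕ.≟ m ⌋ then - y else y

toggle-self : ∀ m y → ∣ y ∣ ≡ m → toggle m y ≡ - y
toggle-self m y ∣y∣≡m with ∣ y ∣ ℕ.≟ m
... | yes _    = refl
... | no  ∣y∣≢m = ⊥-elim (∣y∣≢m ∣y∣≡m)

toggle-other : ∀ m y → ∣ y ∣ ≢ m → toggle m y ≡ y
toggle-other m y ∣y∣≢m with ∣ y ∣ ℕ.≟ m
... | yes ∣y∣≡m = ⊥-elim (∣y∣≢m ∣y∣≡m)
... | no  _    = refl

∣toggle∣ : ∀ m y → ∣ toggle m y ∣ ≡ ∣ y ∣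
∣toggle∣ m y with ∣ y ∣ ℕ.≟ m
... | yes _ = ℤP.∣-i∣≡∣i∣ y
... | no  _ = refl

toggle-<ᵇ : ∀ m a b → m ≤ ∣ a ∣ → m ≤ ∣ b ∣ → ¬ (∣ a ∣ ≡ m × ∣ b ∣ ≡ m) →
            (toggle m a <ᵇ toggle m b) ≡ (a <ᵇ b)
toggle-<ᵇ m a b m≤a m≤b not-both with ∣ a ∣ ℕ.≟ m | ∣ b ∣ ℕ.≟ m
... | yes a≡m | yes b≡m = ⊥-elim (not-both (a≡m , b≡m))
... | yes a≡m | no  b≢m = <ᵇ-negˡ a b (subst (_< ∣ b ∣) (sym a≡m) (ℕP.≤∧≢⇒< m≤b (b≢m ∘ sym)))
... | no  a≢m | yes b≡m = <ᵇ-negʳ a b (subst (_< ∣ a ∣) (sym b≡m) (ℕP.≤∧≢⇒< m≤a (a≢m ∘ sym)))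
... | no  _   | no  _   = refl

occ : ℕ → List ℤ → ℕ
occ m = countᵇ (λ x → ⌊ ∣ x ∣ ℕ.≟ m ⌋)

occ-here : ∀ m a w → ∣ a ∣ ≡ m → occ m (a ∷ w) ≡ suc (occ m w)
occ-here m a w ∣a∣≡m with ∣ a ∣ ℕ.≟ m
... | yes _    = refl
... | no  ∣a∣≢m = ⊥-elim (∣a∣≢m ∣a∣≡m)

occ-there : ∀ m a w → ∣ a ∣ ≢ m → occ m (a ∷ w) ≡ occ m w
occ-there m a w ∣a∣≢m with ∣ a ∣ ℕ.≟ m
... | yes ∣a∣≡m = ⊥-elim (∣a∣≢m ∣a∣≡m)
... | no  _    = refl

occ-∷-≥ : ∀ m a w → occ m w ≤ occ m (a ∷ w)
occ-∷-≥ m a w with ∣ a ∣ ℕ.≟ m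
... | yes _ = ℕP.n≤1+n (occ m w)
... | no  _ = ℕP.≤-refl

occ-map-toggle : ∀ m j w → occ j (map (toggle m) w) ≡ occ j w
occ-map-toggle m j []      = refl
occ-map-toggle m j (y ∷ w) rewrite ∣toggle∣ m y with ∣ y ∣ ℕ.≟ j
... | yes _ = cong suc (occ-map-toggle m j w)
... | no  _ = occ-map-toggle m j w

map-toggle-absent : ∀ m w → occ m w ≡ 0 → map (toggle m) w ≡ w
map-toggle-absent m []      _ = refl
map-toggle-absent m (y ∷ w) occ≡0 with ∣ y ∣ ℕ.≟ m
... | yes _ = ⊥-elim (ℕP.1+n≢0 occ≡0)
... | no  _ = cong (y ∷_) (map-toggle-absent m w occ≡0)

oneTo-unique : ∀ n → Unique (oneTo n)
oneTo-unique n = UniqueP.map⁺ ℕP.suc-injective (UniqueP.upTo⁺ n)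

∈-oneTo⁺ : ∀ {j n} → 1 ≤ j → j ≤ n → j ∈ oneTo n
∈-oneTo⁺ {suc i} _ i<n = ∈-map⁺ suc (∈-upTo⁺ i<n)

∈-oneTo⁻ : ∀ {j n} → j ∈ oneTo n → 1 ≤ j × j ≤ n
∈-oneTo⁻ j∈ with ∈-map⁻ suc j∈
... | i , i∈ , refl = s≤s z≤n , ∈-upTo⁻ i∈

letters-nonzero : ∀ n → All (λ a → 1 ≤ ∣ a ∣) (letters n)
letters-nonzero n =
  AllP.concat⁺ (AllP.map⁺ (AllP.map⁺ (AllP.applyUpTo⁺₂ _ n (λ _ → s≤s z≤n ∷ s≤s z≤n ∷ []))))

∑-letters : ∀ n (h : ℤ → ℤ) → ∑ (letters n) h ≡ ∑ (oneTo n) (λ k → h (+ k) + h (- + k))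
∑-letters n h = trans (∑-concatMap (λ k → + k ∷ - + k ∷ []) (oneTo n) h)
                      (∑-cong (oneTo n) (λ k → cong (_+_ (h (+ k))) (ℤP.+-identityʳ (h (- + k)))))

∑-letters-toggle : ∀ n m (h : ℤ → ℤ) → ∑ (letters n) (h ∘ toggle m) ≡ ∑ (letters n) h
∑-letters-toggle n m h = begin
  ∑ (letters n) (h ∘ toggle m)                                    ≡⟨ ∑-letters n (h ∘ toggle m) ⟩
  ∑ (oneTo n) (λ k → h (toggle m (+ k)) + h (toggle m (- + k)))  ≡⟨ ∑-cong (oneTo n) pair-invariant ⟩
  ∑ (oneTo n) (λ k → h (+ k) + h (- + k))                         ≡⟨ sym (∑-letters n h) ⟩
  ∑ (letters n) h                                                 ∎
  where
  open ≡-Reasoning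
  pair-invariant : ∀ k → h (toggle m (+ k)) + h (toggle m (- + k)) ≡ h (+ k) + h (- + k)
  pair-invariant k = by-cases (k ℕ.≟ m)
    where
    ∣-k∣≡k : ∣ - + k ∣ ≡ k
    ∣-k∣≡k = ℤP.∣-i∣≡∣i∣ (+ k)
    by-cases : Dec (k ≡ m) → h (toggle m (+ k)) + h (toggle m (- + k)) ≡ h (+ k) + h (- + k)
    by-cases (yes k≡m) = begin
      h (toggle m (+ k)) + h (toggle m (- + k))
        ≡⟨ cong₂ (λ a b → h a + h b) (toggle-self m (+ k) k≡m)
                 (trans (toggle-self m (- + k) (trans ∣-k∣≡k k≡m)) (ℤP.neg-involutive (+ k))) ⟩
      h (- + k) + h (+ k)
        ≡⟨ ℤP.+-comm (h (- + k)) (h (+ k)) ⟩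
      h (+ k) + h (- + k) ∎
    by-cases (no k≢m) = cong₂ (λ a b → h a + h b) (toggle-other m (+ k) k≢m)
                                                 (toggle-other m (- + k) (k≢m ∘ trans (sym ∣-k∣≡k)))

∑-letters-pick : ∀ n m (S : ℤ → ℤ) → 1 ≤ m → m ≤ n →
                 ∑ (letters n) (λ a → if ⌊ ∣ a ∣ ℕ.≟ m ⌋ then S a else 0ℤ) ≡ S (+ m) + S (- + m)
∑-letters-pick n m S 1≤m m≤n =
  trans (∑-letters n _)
        (trans (∑-cong (oneTo n) pair)
               (∑-indicator (λ k → S (+ k) + S (- + k)) (oneTo-unique n) (∈-oneTo⁺ 1≤m m≤n)))
  where
  pair : ∀ k → (if ⌊ k ℕ.≟ m ⌋ then S (+ k) else 0ℤ)
                 + (if ⌊ ∣ - + k ∣ ℕ.≟ m ⌋ then S (- + k) else 0ℤ)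
               ≡ (if ⌊ k ℕ.≟ m ⌋ then S (+ k) + S (- + k) else 0ℤ)
  pair k rewrite ℤP.∣-i∣≡∣i∣ (+ k) with k ℕ.≟ m
  ... | yes _ = refl
  ... | no  _ = refl

odd : ℕ → Bool
odd n = not (isEven n)

odd-+ : ∀ a b → odd (a ℕ.+ b) ≡ odd a xor odd b
odd-+ zero    b = refl
odd-+ (suc a) b = trans (cong not (odd-+ a b)) (BoolP.not-distribˡ-xor (odd a) (odd b))

odd-if : ∀ b → odd (if b then 1 else 0) ≡ b
odd-if true  = refl
odd-if false = refl

odd-countᵇ-∷ : ∀ (p : A → Bool) y xs → odd (countᵇ p (y ∷ xs)) ≡ p y xor odd (countᵇ p xs)
odd-countᵇ-∷ p y xs with p y
... | true  = refl
... | false = refl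

odd-countᵇ-++ : ∀ (p : A → Bool) xs ys →
                odd (countᵇ p (xs ++ ys)) ≡ odd (countᵇ p xs) xor odd (countᵇ p ys)
odd-countᵇ-++ p xs ys = trans (cong odd (countᵇ-++ p xs ys)) (odd-+ (countᵇ p xs) (countᵇ p ys))

xor-interchange : ∀ a b c d → (a xor b) xor (c xor d) ≡ (a xor c) xor (b xor d)
xor-interchange = solve 4 (λ a b c d → (a :+ b) :+ (c :+ d) := (a :+ c) :+ (b :+ d)) refl
  where open xor-∧-Solver

pairParity : ℤ → ℤ → Bool
pairParity x y = (y <ᵇ x) xor (y <ᵇ (- x))

crossParity : ℤ → List ℤ → Bool
crossParity x ys = odd (countᵇ (_<ᵇ x) ys) xor odd (countᵇ (_<ᵇ (- x)) ys)

odd-invB-∷ : ∀ x xs → odd (invB (x ∷ xs)) ≡ (crossParity x xs xor (x <ᵇ 0ℤ)) xor odd (invB xs)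
odd-invB-∷ x xs = begin
  odd (below ℕ.+ below⁻ ℕ.+ negative ℕ.+ invB xs)
    ≡⟨ odd-+ (below ℕ.+ below⁻ ℕ.+ negative) (invB xs) ⟩
  odd (below ℕ.+ below⁻ ℕ.+ negative) xor odd (invB xs)
    ≡⟨ cong (_xor odd (invB xs)) (odd-+ (below ℕ.+ below⁻) negative) ⟩
  (odd (below ℕ.+ below⁻) xor odd negative) xor odd (invB xs)
    ≡⟨ cong₂ (λ c s → (c xor s) xor odd (invB xs)) (odd-+ below below⁻) (odd-if (x <ᵇ 0ℤ)) ⟩
  (crossParity x xs xor (x <ᵇ 0ℤ)) xor odd (invB xs) ∎
  where
  open ≡-Reasoning
  below below⁻ negative : ℕ
  below    = countᵇ (_<ᵇ x) xs
  below⁻   = countᵇ (_<ᵇ (- x)) xs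
  negative = if x <ᵇ 0ℤ then 1 else 0

crossParity-∷ : ∀ x y ys → crossParity x (y ∷ ys) ≡ pairParity x y xor crossParity x ys
crossParity-∷ x y ys =
  trans (cong₂ _xor_ (odd-countᵇ-∷ (_<ᵇ x) y ys) (odd-countᵇ-∷ (_<ᵇ (- x)) y ys))
        (xor-interchange (y <ᵇ x) (odd (countᵇ (_<ᵇ x) ys)) (y <ᵇ (- x)) (odd (countᵇ (_<ᵇ (- x)) ys)))

crossParity-++ : ∀ x xs ys → crossParity x (xs ++ ys) ≡ crossParity x xs xor crossParity x ys
crossParity-++ x xs ys =
  trans (cong₂ _xor_ (odd-countᵇ-++ (_<ᵇ x) xs ys) (odd-countᵇ-++ (_<ᵇ (- x)) xs ys))
        (xor-interchange (odd (countᵇ (_<ᵇ x) xs)) (odd (countᵇ (_<ᵇ x) ys))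
                         (odd (countᵇ (_<ᵇ (- x)) xs)) (odd (countᵇ (_<ᵇ (- x)) ys)))

crossParity-neg : ∀ x ys → crossParity (- x) ys ≡ crossParity x ys
crossParity-neg x ys =
  trans (cong (λ z → odd (countᵇ (_<ᵇ (- x)) ys) xor odd (countᵇ (_<ᵇ z) ys)) (ℤP.neg-involutive x))
        (BoolP.xor-comm (odd (countᵇ (_<ᵇ (- x)) ys)) (odd (countᵇ (_<ᵇ x) ys)))

pairParity-neg : ∀ x y → ∣ x ∣ ≢ ∣ y ∣ → pairParity x (- y) ≡ pairParity x y
pairParity-neg x y ∣x∣≢∣y∣ = begin
  ((- y) <ᵇ x) xor ((- y) <ᵇ (- x))
    ≡⟨ cong (λ z → ((- y) <ᵇ z) xor ((- y) <ᵇ (- x))) (sym (ℤP.neg-involutive x)) ⟩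
  ((- y) <ᵇ (- - x)) xor ((- y) <ᵇ (- x))
    ≡⟨ cong₂ _xor_ (<ᵇ-neg (- x) y) (<ᵇ-neg x y) ⟩
  ((- x) <ᵇ y) xor (x <ᵇ y)
    ≡⟨ cong₂ _xor_ (<ᵇ-flip y (- x) (-x≢y ∘ sym)) (<ᵇ-flip y x (x≢y ∘ sym)) ⟩
  not (y <ᵇ (- x)) xor not (y <ᵇ x)
    ≡⟨ BoolP.xor-annihilates-not (y <ᵇ (- x)) (y <ᵇ x) ⟩
  (y <ᵇ (- x)) xor (y <ᵇ x)
    ≡⟨ BoolP.xor-comm (y <ᵇ (- x)) (y <ᵇ x) ⟩
  (y <ᵇ x) xor (y <ᵇ (- x)) ∎
  where
  open ≡-Reasoning
  x≢y : x ≢ y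
  x≢y = ∣x∣≢∣y∣ ∘ cong ∣_∣
  -x≢y : - x ≢ y
  -x≢y = ∣x∣≢∣y∣ ∘ trans (sym (ℤP.∣-i∣≡∣i∣ x)) ∘ cong ∣_∣

pairParity-smaller : ∀ x z → ∣ x ∣ < ∣ z ∣ → pairParity x z ≡ false
pairParity-smaller x z ∣x∣<∣z∣ =
  trans (cong ((z <ᵇ x) xor_) (<ᵇ-negʳ z x ∣x∣<∣z∣)) (BoolP.xor-same (z <ᵇ x))

crossParity-toggle : ∀ m x ys → ∣ x ∣ ≢ m → crossParity x (map (toggle m) ys) ≡ crossParity x ys
crossParity-toggle m x []       _     = refl
crossParity-toggle m x (y ∷ ys) ∣x∣≢m =
  trans (crossParity-∷ x (toggle m y) (map (toggle m) ys))
        (trans (cong₂ _xor_ (pair-invariant (∣ y ∣ ℕ.≟ m)) (crossParity-toggle m x ys ∣x∣≢m))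
               (sym (crossParity-∷ x y ys)))
  where
  pair-invariant : Dec (∣ y ∣ ≡ m) → pairParity x (toggle m y) ≡ pairParity x y
  pair-invariant (yes ∣y∣≡m) = trans (cong (pairParity x) (toggle-self m y ∣y∣≡m))
                                     (pairParity-neg x y (λ ∣x∣≡∣y∣ → ∣x∣≢m (trans ∣x∣≡∣y∣ ∣y∣≡m)))
  pair-invariant (no ∣y∣≢m)  = cong (pairParity x) (toggle-other m y ∣y∣≢m)

odd-invB-toggle : ∀ j xs → occ (suc j) xs ≡ 1 →
                  odd (invB (map (toggle (suc j)) xs)) ≡ not (odd (invB xs))
odd-invB-toggle j (x ∷ xs) occ≡1 with ∣ x ∣ ℕ.≟ suc j
... | yes ∣x∣≡1+j rewrite map-toggle-absent (suc j) xs (ℕP.suc-injective occ≡1) = begin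
  odd (invB ((- x) ∷ xs))
    ≡⟨ odd-invB-∷ (- x) xs ⟩
  (crossParity (- x) xs xor ((- x) <ᵇ 0ℤ)) xor odd (invB xs)
    ≡⟨ cong₂ (λ c s → (c xor s) xor odd (invB xs)) (crossParity-neg x xs) -x<0 ⟩
  (crossParity x xs xor not (x <ᵇ 0ℤ)) xor odd (invB xs)
    ≡⟨ cong (_xor odd (invB xs)) (sym (BoolP.not-distribʳ-xor (crossParity x xs) (x <ᵇ 0ℤ))) ⟩
  not (crossParity x xs xor (x <ᵇ 0ℤ)) xor odd (invB xs)
    ≡⟨ sym (BoolP.not-distribˡ-xor (crossParity x xs xor (x <ᵇ 0ℤ)) (odd (invB xs))) ⟩
  not ((crossParity x xs xor (x <ᵇ 0ℤ)) xor odd (invB xs))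
    ≡⟨ cong not (sym (odd-invB-∷ x xs)) ⟩
  not (odd (invB (x ∷ xs))) ∎
  where
  open ≡-Reasoning
  x≢0 : x ≢ 0ℤ
  x≢0 x≡0 = ℕP.1+n≢0 (trans (sym ∣x∣≡1+j) (cong ∣_∣ x≡0))
  -x<0 : ((- x) <ᵇ 0ℤ) ≡ not (x <ᵇ 0ℤ)
  -x<0 = trans (<ᵇ-neg 0ℤ x) (<ᵇ-flip x 0ℤ x≢0)
... | no ∣x∣≢1+j = begin
  odd (invB (x ∷ map (toggle (suc j)) xs))
    ≡⟨ odd-invB-∷ x (map (toggle (suc j)) xs) ⟩
  (crossParity x (map (toggle (suc j)) xs) xor (x <ᵇ 0ℤ)) xor odd (invB (map (toggle (suc j)) xs))
    ≡⟨ cong₂ (λ c i → (c xor (x <ᵇ 0ℤ)) xor i) (crossParity-toggle (suc j) x xs ∣x∣≢1+j)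
                                                (odd-invB-toggle j xs occ≡1) ⟩
  (crossParity x xs xor (x <ᵇ 0ℤ)) xor not (odd (invB xs))
    ≡⟨ sym (BoolP.not-distribʳ-xor (crossParity x xs xor (x <ᵇ 0ℤ)) (odd (invB xs))) ⟩
  not ((crossParity x xs xor (x <ᵇ 0ℤ)) xor odd (invB xs))
    ≡⟨ cong not (sym (odd-invB-∷ x xs)) ⟩
  not (odd (invB (x ∷ xs))) ∎
  where open ≡-Reasoning

odd-invB-∷ʳ : ∀ xs z → All (λ x → ∣ x ∣ < ∣ z ∣) xs →
              odd (invB (xs ++ z ∷ [])) ≡ odd (invB xs) xor (z <ᵇ 0ℤ)
odd-invB-∷ʳ []       z []             = trans (odd-invB-∷ z []) (BoolP.xor-identityʳ (z <ᵇ 0ℤ))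
odd-invB-∷ʳ (x ∷ xs) z (x<z ∷ xs<z) = begin
  odd (invB (x ∷ xs ++ z ∷ []))
    ≡⟨ odd-invB-∷ x (xs ++ z ∷ []) ⟩
  (crossParity x (xs ++ z ∷ []) xor (x <ᵇ 0ℤ)) xor odd (invB (xs ++ z ∷ []))
    ≡⟨ cong₂ (λ c i → (c xor (x <ᵇ 0ℤ)) xor i) cross-z (odd-invB-∷ʳ xs z xs<z) ⟩
  (crossParity x xs xor (x <ᵇ 0ℤ)) xor (odd (invB xs) xor (z <ᵇ 0ℤ))
    ≡⟨ sym (BoolP.xor-assoc (crossParity x xs xor (x <ᵇ 0ℤ)) (odd (invB xs)) (z <ᵇ 0ℤ)) ⟩
  ((crossParity x xs xor (x <ᵇ 0ℤ)) xor odd (invB xs)) xor (z <ᵇ 0ℤ)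
    ≡⟨ cong (_xor (z <ᵇ 0ℤ)) (sym (odd-invB-∷ x xs)) ⟩
  odd (invB (x ∷ xs)) xor (z <ᵇ 0ℤ) ∎
  where
  open ≡-Reasoning
  cross-z : crossParity x (xs ++ z ∷ []) ≡ crossParity x xs
  cross-z = begin
    crossParity x (xs ++ z ∷ [])
      ≡⟨ crossParity-++ x xs (z ∷ []) ⟩
    crossParity x xs xor crossParity x (z ∷ [])
      ≡⟨ cong (crossParity x xs xor_) (crossParity-∷ x z []) ⟩
    crossParity x xs xor (pairParity x z xor false)
      ≡⟨ cong (λ p → crossParity x xs xor (p xor false)) (pairParity-smaller x z x<z) ⟩
    crossParity x xs xor false
      ≡⟨ BoolP.xor-identityʳ (crossParity x xs) ⟩
    crossParity x xs ∎

zigzagEntry : ℕ → ℤ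
zigzagEntry j = if isEven j then - + j else + j

wrongEntry : ℕ → ℤ
wrongEntry j = if isEven j then + j else - + j

zigzag : ℕ → List ℤ
zigzag zero    = []
zigzag (suc k) = zigzag k ++ zigzagEntry (suc k) ∷ []

-- The entry preceding a suffix of zigzag k, with 0 playing π₀ in 0 < π₁.
zigzagLast : ℕ → ℤ
zigzagLast zero    = 0ℤ
zigzagLast (suc k) = zigzagEntry (suc k)

alternating : Bool → List ℤ → Bool
alternating true  = altUp
alternating false = altDown

isSnakeB-zigzag-++ : ∀ k v → isSnakeB (zigzag k ++ v) ≡ alternating (isEven k) (zigzagLast k ∷ v)
isSnakeB-zigzag-++ k v = trans (isSnakeB-altUp (zigzag k ++ v)) (altUp-zigzag k v)
  where
  isSnakeB-altUp : ∀ w → isSnakeB w ≡ altUp (0ℤ ∷ w)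
  isSnakeB-altUp []      = refl
  isSnakeB-altUp (x ∷ w) = refl
  zigzag-turn : ∀ k v → alternating (isEven k) (zigzagLast k ∷ zigzagEntry (suc k) ∷ v)
                        ≡ alternating (isEven (suc k)) (zigzagEntry (suc k) ∷ v)
  zigzag-turn zero    v = refl
  zigzag-turn (suc k) v with isEven k
  ... | true  = refl
  ... | false = refl
  altUp-zigzag : ∀ k v → altUp (0ℤ ∷ zigzag k ++ v) ≡ alternating (isEven k) (zigzagLast k ∷ v)
  altUp-zigzag zero    v = refl
  altUp-zigzag (suc k) v =
    trans (cong (λ w → altUp (0ℤ ∷ w)) (ListP.++-assoc (zigzag k) (zigzagEntry (suc k) ∷ []) v))
          (trans (altUp-zigzag k (zigzagEntry (suc k) ∷ v)) (zigzag-turn k v))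

isSnakeB-zigzag-wrongEntry : ∀ k v → isSnakeB (zigzag k ++ wrongEntry (suc k) ∷ v) ≡ false
isSnakeB-zigzag-wrongEntry k v = trans (isSnakeB-zigzag-++ k (wrongEntry (suc k) ∷ v)) (wrong-turn k)
  where
  wrong-turn : ∀ k → alternating (isEven k) (zigzagLast k ∷ wrongEntry (suc k) ∷ v) ≡ false
  wrong-turn zero    = refl
  wrong-turn (suc k) with isEven k
  ... | true  = cong (_∧ altUp (+ suc (suc k) ∷ v))
                     (<ᵇ-false {+ suc (suc k)} {+ suc k}
                               λ { (+<+ 2+k<1+k) → ℕP.<-asym 2+k<1+k (ℕP.n<1+n (suc k)) })
  ... | false = cong (_∧ altDown (-[1+ suc k ] ∷ v))
                     (<ᵇ-false { -[1+ k ]} { -[1+ suc k ]}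
                               λ { (-<- 1+k<k) → ℕP.<-asym 1+k<k (ℕP.n<1+n k) })

isSnakeB-zigzag : ∀ n → isSnakeB (zigzag n) ≡ true
isSnakeB-zigzag n = trans (cong isSnakeB (sym (ListP.++-identityʳ (zigzag n))))
                          (trans (isSnakeB-zigzag-++ n []) (single (isEven n)))
  where
  single : ∀ b → alternating b (zigzagLast n ∷ []) ≡ true
  single true  = refl
  single false = refl

∣zigzagEntry∣ : ∀ j → ∣ zigzagEntry j ∣ ≡ j
∣zigzagEntry∣ j with isEven j
... | true  = ℤP.∣-i∣≡∣i∣ (+ j)
... | false = refl

zigzag-bounded : ∀ k → All (λ y → ∣ y ∣ ≤ k) (zigzag k)
zigzag-bounded zero    = []
zigzag-bounded (suc k) = AllP.++⁺ (All.map ℕP.m≤n⇒m≤1+n (zigzag-bounded k))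
                                  (ℕP.≤-reflexive (∣zigzagEntry∣ (suc k)) ∷ [])

occ-zigzag-beyond : ∀ k j → k < j → occ j (zigzag k) ≡ 0
occ-zigzag-beyond zero    j _   = refl
occ-zigzag-beyond (suc k) j 1+k<j =
  trans (countᵇ-++ _ (zigzag k) (zigzagEntry (suc k) ∷ []))
        (cong₂ ℕ._+_ (occ-zigzag-beyond k j (ℕP.<-trans (ℕP.n<1+n k) 1+k<j))
                     (occ-there j (zigzagEntry (suc k)) []
                                (ℕP.<⇒≢ 1+k<j ∘ trans (sym (∣zigzagEntry∣ (suc k))))))

occ-zigzag-within : ∀ k j → 1 ≤ j → j ≤ k → occ j (zigzag k) ≡ 1
occ-zigzag-within zero    j (s≤s _) ()
occ-zigzag-within (suc k) j 1≤j j≤1+k =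
  trans (countᵇ-++ _ (zigzag k) (zigzagEntry (suc k) ∷ [])) (by-cases (j ℕ.≟ suc k))
  where
  by-cases : Dec (j ≡ suc k) → occ j (zigzag k) ℕ.+ occ j (zigzagEntry (suc k) ∷ []) ≡ 1
  by-cases (yes refl) = cong₂ ℕ._+_ (occ-zigzag-beyond k (suc k) ℕP.≤-refl)
                                    (occ-here (suc k) (zigzagEntry (suc k)) [] (∣zigzagEntry∣ (suc k)))
  by-cases (no j≢1+k) =
    cong₂ ℕ._+_ (occ-zigzag-within k j 1≤j (ℕP.≤-pred (ℕP.≤∧≢⇒< j≤1+k j≢1+k)))
                (occ-there j (zigzagEntry (suc k)) []
                           (λ ∣e∣≡j → j≢1+k (trans (sym ∣e∣≡j) (∣zigzagEntry∣ (suc k)))))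

∧-true⁻ : ∀ {a b} → a ∧ b ≡ true → a ≡ true × b ≡ true
∧-true⁻ {true} {true} refl = refl , refl

allᵇ-sound : ∀ (p : A → Bool) {xs x} → allᵇ p xs ≡ true → x ∈ xs → p x ≡ true
allᵇ-sound p {x ∷ xs} all≡true (here refl)  = proj₁ (∧-true⁻ all≡true)
allᵇ-sound p {x ∷ xs} all≡true (there x∈xs) = allᵇ-sound p (proj₂ (∧-true⁻ all≡true)) x∈xs

allᵇ-complete : ∀ (p : A → Bool) xs → (∀ {x} → x ∈ xs → p x ≡ true) → allᵇ p xs ≡ true
allᵇ-complete p []       _    = refl
allᵇ-complete p (x ∷ xs) p∈xs = cong₂ _∧_ (p∈xs (here refl)) (allᵇ-complete p xs (p∈xs ∘ there))

allᵇ-cong : ∀ {p q : A → Bool} xs → (∀ x → p x ≡ q x) → allᵇ p xs ≡ allᵇ q xs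
allᵇ-cong []       p≗q = refl
allᵇ-cong (x ∷ xs) p≗q = cong₂ _∧_ (p≗q x) (allᵇ-cong xs p≗q)

isSignedPerm⇒occ≡1 : ∀ n w → isSignedPerm n w ≡ true → ∀ j → 1 ≤ j → j ≤ n → occ j w ≡ 1
isSignedPerm⇒occ≡1 n w perm j 1≤j j≤n =
  toWitness (Equivalence.from BoolP.T-≡ (allᵇ-sound _ perm (∈-oneTo⁺ 1≤j j≤n)))

occ≡1⇒isSignedPerm : ∀ n w → (∀ j → 1 ≤ j → j ≤ n → occ j w ≡ 1) → isSignedPerm n w ≡ true
occ≡1⇒isSignedPerm n w occ≡1 = allᵇ-complete _ (oneTo n) λ j∈ →
  let 1≤j , j≤n = ∈-oneTo⁻ j∈ in Equivalence.to BoolP.T-≡ (fromWitness (occ≡1 _ 1≤j j≤n))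

isSignedPerm-toggle : ∀ n m w → isSignedPerm n (map (toggle m) w) ≡ isSignedPerm n w
isSignedPerm-toggle n m w = allᵇ-cong (oneTo n) (λ j → cong (λ c → ⌊ c ℕ.≟ 1 ⌋) (occ-map-toggle m j w))

isSignedPerm-zigzag : ∀ n → isSignedPerm n (zigzag n) ≡ true
isSignedPerm-zigzag n = occ≡1⇒isSignedPerm n (zigzag n) (occ-zigzag-within n)

odd-⌊/2⌋-suc : ∀ k → odd ⌊ suc k /2⌋ ≡ odd ⌊ k /2⌋ xor isEven (suc k)
odd-⌊/2⌋-suc zero    = refl
odd-⌊/2⌋-suc (suc k) = begin
  not (odd ⌊ k /2⌋)
    ≡⟨ cancel (odd ⌊ k /2⌋) (isEven k) ⟩
  (odd ⌊ k /2⌋ xor not (isEven k)) xor not (not (isEven k))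
    ≡⟨ cong (_xor isEven (suc (suc k))) (sym (odd-⌊/2⌋-suc k)) ⟩
  odd ⌊ suc k /2⌋ xor isEven (suc (suc k)) ∎
  where
  open ≡-Reasoning
  cancel : ∀ o e → not o ≡ (o xor not e) xor not (not e)
  cancel = solve 2 (λ o e → con true :+ o := (o :+ (con true :+ e)) :+ (con true :+ (con true :+ e))) refl
    where open xor-∧-Solver

isEven-invB-zigzag : ∀ n → isEven (invB (zigzag n)) ≡ isEven ⌊ n /2⌋
isEven-invB-zigzag n = BoolP.not-injective (odd-invB-zigzag n)
  where
  negative-entry : ∀ j → (zigzagEntry (suc j) <ᵇ 0ℤ) ≡ isEven (suc j)
  negative-entry j with isEven (suc j)
  ... | true  = refl
  ... | false = refl
  odd-invB-zigzag : ∀ n → odd (invB (zigzag n)) ≡ odd ⌊ n /2⌋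
  odd-invB-zigzag zero    = refl
  odd-invB-zigzag (suc k) = begin
    odd (invB (zigzag k ++ zigzagEntry (suc k) ∷ []))
      ≡⟨ odd-invB-∷ʳ (zigzag k) (zigzagEntry (suc k)) smaller ⟩
    odd (invB (zigzag k)) xor (zigzagEntry (suc k) <ᵇ 0ℤ)
      ≡⟨ cong₂ _xor_ (odd-invB-zigzag k) (negative-entry k) ⟩
    odd ⌊ k /2⌋ xor isEven (suc k)
      ≡⟨ sym (odd-⌊/2⌋-suc k) ⟩
    odd ⌊ suc k /2⌋ ∎
    where
    open ≡-Reasoning
    smaller : All (λ y → ∣ y ∣ < ∣ zigzagEntry (suc k) ∣) (zigzag k)
    smaller = All.map (λ {y} ∣y∣≤k → subst (∣ y ∣ <_) (sym (∣zigzagEntry∣ (suc k))) (s≤s ∣y∣≤k))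
                      (zigzag-bounded k)

alternating-∷∷ : ∀ d x y w →
                 alternating d (x ∷ y ∷ w) ≡ (if d then x <ᵇ y else y <ᵇ x) ∧ alternating (not d) (y ∷ w)
alternating-∷∷ true  x y w = refl
alternating-∷∷ false x y w = refl

occ≤1⇒not-both : ∀ m a b w → occ m (a ∷ b ∷ w) ≤ 1 → ¬ (∣ a ∣ ≡ m × ∣ b ∣ ≡ m)
occ≤1⇒not-both m a b w occ≤1 (∣a∣≡m , ∣b∣≡m) =
  ℕP.≤⇒≯ occ≤1 (subst (1 <_) (sym twice) (s≤s (s≤s z≤n)))
  where
  twice : occ m (a ∷ b ∷ w) ≡ suc (suc (occ m w))
  twice = trans (occ-here m a (b ∷ w) ∣a∣≡m) (cong suc (occ-here m b w ∣b∣≡m))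

alternating-toggle : ∀ m d w → All (λ y → m ≤ ∣ y ∣) w → occ m w ≤ 1 →
                     alternating d (map (toggle m) w) ≡ alternating d w
alternating-toggle m d     []          _                 _     = refl
alternating-toggle m true  (a ∷ [])    _                 _     = refl
alternating-toggle m false (a ∷ [])    _                 _     = refl
alternating-toggle m true  (a ∷ b ∷ w) (m≤a ∷ m≤b ∷ m≤w) occ≤1 =
  cong₂ _∧_ (toggle-<ᵇ m a b m≤a m≤b (occ≤1⇒not-both m a b w occ≤1))
            (alternating-toggle m false (b ∷ w) (m≤b ∷ m≤w) (ℕP.≤-trans (occ-∷-≥ m a (b ∷ w)) occ≤1))
alternating-toggle m false (a ∷ b ∷ w) (m≤a ∷ m≤b ∷ m≤w) occ≤1 =
  cong₂ _∧_ (toggle-<ᵇ m b a m≤b m≤a (occ≤1⇒not-both m a b w occ≤1 ∘ swap))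
            (alternating-toggle m true (b ∷ w) (m≤b ∷ m≤w) (ℕP.≤-trans (occ-∷-≥ m a (b ∷ w)) occ≤1))

occ-absent⇒All-> : ∀ k w → All (λ y → 1 ≤ ∣ y ∣) w → (∀ j → 1 ≤ j → j ≤ k → occ j w ≡ 0) →
                   All (λ y → k < ∣ y ∣) w
occ-absent⇒All-> k []      []          _      = []
occ-absent⇒All-> k (y ∷ w) (1≤y ∷ 1≤w) absent =
  large (∣ y ∣ ℕ.≤? k) ∷ occ-absent⇒All-> k w 1≤w absent-in-w
  where
  large : Dec (∣ y ∣ ≤ k) → k < ∣ y ∣
  large (yes ∣y∣≤k) =
    ⊥-elim (ℕP.1+n≢0 (trans (sym (occ-here ∣ y ∣ y w refl)) (absent ∣ y ∣ 1≤y ∣y∣≤k)))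
  large (no  ∣y∣≰k) = ℕP.≰⇒> ∣y∣≰k
  absent-in-w : ∀ j → 1 ≤ j → j ≤ k → occ j w ≡ 0
  absent-in-w j 1≤j j≤k = ℕP.n≤0⇒n≡0 (subst (occ j w ≤_) (absent j 1≤j j≤k) (occ-∷-≥ j y w))

snakeWeight-nonSnake : ∀ n w → isSnakeB w ≡ false → snakeWeight n w ≡ 0ℤ
snakeWeight-nonSnake n w not-snake rewrite not-snake | BoolP.∧-zeroʳ (isSignedPerm n w) = refl

sign-not : ∀ b → sign (not b) ≡ - sign b
sign-not true  = refl
sign-not false = refl

snakeWeight-neg : ∀ n x y → isSignedPerm n y ≡ isSignedPerm n x →
                  (isSignedPerm n x ≡ true →
                     isSnakeB y ≡ isSnakeB x × isEven (invB y) ≡ not (isEven (invB x))) →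
                  snakeWeight n y ≡ - snakeWeight n x
snakeWeight-neg n x y perm-eq reversal rewrite perm-eq with isSignedPerm n x
... | false = refl
... | true  with reversal refl
...   | snake-eq , parity-flip rewrite snake-eq | parity-flip with isSnakeB x
...     | false = refl
...     | true  = sign-not (isEven (invB x))

snakeWeight-toggle : ∀ n k a v → suc k ≤ n → All (λ y → 1 ≤ ∣ y ∣) (a ∷ v) → ∣ a ∣ ≢ suc k →
                     snakeWeight n (zigzag k ++ a ∷ map (toggle (suc k)) v)
                       ≡ - snakeWeight n (zigzag k ++ a ∷ v)
snakeWeight-toggle n k a v 1+k≤n nonzero ∣a∣≢1+k =
  snakeWeight-neg n x y perm-eq (λ perm → snake-eq perm , parity-flip perm)
  where
  open ≡-Reasoning
  m = suc k
  x = zigzag k ++ a ∷ v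
  y = zigzag k ++ a ∷ map (toggle m) v

  y≡toggled : y ≡ map (toggle m) x
  y≡toggled = sym (trans (ListP.map-++ (toggle m) (zigzag k) (a ∷ v))
                         (cong₂ _++_ (map-toggle-absent m (zigzag k) (occ-zigzag-beyond k m ℕP.≤-refl))
                                     (cong (_∷ map (toggle m) v) (toggle-other m a ∣a∣≢1+k))))

  perm-eq : isSignedPerm n y ≡ isSignedPerm n x
  perm-eq = trans (cong (isSignedPerm n) y≡toggled) (isSignedPerm-toggle n m x)

  parity-flip : isSignedPerm n x ≡ true → isEven (invB y) ≡ not (isEven (invB x))
  parity-flip perm = BoolP.not-injective (trans (cong (odd ∘ invB) y≡toggled)
    (odd-invB-toggle k x (isSignedPerm⇒occ≡1 n x perm m (s≤s z≤n) 1+k≤n)))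

  occ-split : isSignedPerm n x ≡ true → ∀ j → 1 ≤ j → j ≤ n → occ j (zigzag k) ℕ.+ occ j (a ∷ v) ≡ 1
  occ-split perm j 1≤j j≤n =
    trans (sym (countᵇ-++ _ (zigzag k) (a ∷ v))) (isSignedPerm⇒occ≡1 n x perm j 1≤j j≤n)

  snake-eq : isSignedPerm n x ≡ true → isSnakeB y ≡ isSnakeB x
  snake-eq perm = begin
    isSnakeB y
      ≡⟨ isSnakeB-zigzag-++ k (a ∷ map (toggle m) v) ⟩
    alternating e (l ∷ a ∷ map (toggle m) v)
      ≡⟨ alternating-∷∷ e l a (map (toggle m) v) ⟩
    first ∧ alternating (not e) (a ∷ map (toggle m) v)
      ≡⟨ cong (λ b → first ∧ alternating (not e) (b ∷ map (toggle m) v))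
              (sym (toggle-other m a ∣a∣≢1+k)) ⟩
    first ∧ alternating (not e) (map (toggle m) (a ∷ v))
      ≡⟨ cong (first ∧_) (alternating-toggle m (not e) (a ∷ v) large occ-m≤1) ⟩
    first ∧ alternating (not e) (a ∷ v)
      ≡⟨ sym (alternating-∷∷ e l a v) ⟩
    alternating e (l ∷ a ∷ v)
      ≡⟨ sym (isSnakeB-zigzag-++ k (a ∷ v)) ⟩
    isSnakeB x ∎
    where
    e = isEven k
    l = zigzagLast k
    first = if e then l <ᵇ a else a <ᵇ l
    occ-m≤1 : occ m (a ∷ v) ≤ 1
    occ-m≤1 = ℕP.≤-reflexive (subst (λ c → c ℕ.+ occ m (a ∷ v) ≡ 1) (occ-zigzag-beyond k m ℕP.≤-refl)
                                    (occ-split perm m (s≤s z≤n) 1+k≤n))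
    large : All (λ y → m ≤ ∣ y ∣) (a ∷ v)
    large = occ-absent⇒All-> k (a ∷ v) nonzero λ j 1≤j j≤k →
      ℕP.suc-injective (subst (λ c → c ℕ.+ occ j (a ∷ v) ≡ 1) (occ-zigzag-within k j 1≤j j≤k)
                              (occ-split perm j 1≤j (ℕP.≤-trans j≤k (ℕP.<⇒≤ 1+k≤n))))

zigzag-or-wrong : ∀ (S : ℤ → ℤ) j → S (+ j) + S (- + j) ≡ S (zigzagEntry j) + S (wrongEntry j)
zigzag-or-wrong S j with isEven j
... | true  = ℤP.+-comm (S (+ j)) (S (- + j))
... | false = refl

∑-zigzag-extend : ∀ n k r → suc k ≤ n →
  ∑ (words (suc r) (letters n)) (λ v → snakeWeight n (zigzag k ++ v))
    ≡ ∑ (words r (letters n)) (λ v → snakeWeight n (zigzag (suc k) ++ v))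
∑-zigzag-extend n k r 1+k≤n = begin
  ∑ (words (suc r) L) (λ v → snakeWeight n (zigzag k ++ v))  ≡⟨ ∑-words-suc L r _ ⟩
  ∑ L S                                                       ≡⟨ ∑-cong-All L (letters-nonzero n) only-±m ⟩
  ∑ L (λ a → if ⌊ ∣ a ∣ ℕ.≟ m ⌋ then S a else 0ℤ)            ≡⟨ ∑-letters-pick n m S (s≤s z≤n) 1+k≤n ⟩
  S (+ m) + S (- + m)                                         ≡⟨ zigzag-or-wrong S m ⟩
  S (zigzagEntry m) + S (wrongEntry m)                        ≡⟨ cong (_+_ (S (zigzagEntry m))) S-wrong ⟩
  S (zigzagEntry m) + 0ℤ                                      ≡⟨ ℤP.+-identityʳ _ ⟩
  S (zigzagEntry m)                                           ≡⟨ ∑-cong W zigzag-snoc ⟩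
  ∑ W (λ v → snakeWeight n (zigzag m ++ v))                   ∎
  where
  open ≡-Reasoning
  m = suc k
  L = letters n
  W = words r L
  S : ℤ → ℤ
  S a = ∑ W (λ v → snakeWeight n (zigzag k ++ a ∷ v))

  S-other : ∀ a → 1 ≤ ∣ a ∣ → ∣ a ∣ ≢ m → S a ≡ 0ℤ
  S-other a 1≤a ∣a∣≢m = self-neg⇒0 (S a) (begin
    S a
      ≡⟨ sym (∑-words-map L (toggle m) (∑-letters-toggle n m) r _) ⟩
    ∑ W (λ v → snakeWeight n (zigzag k ++ a ∷ map (toggle m) v))
      ≡⟨ ∑-words-cong-All L r (letters-nonzero n)
           (λ v 1≤v → snakeWeight-toggle n k a v 1+k≤n (1≤a ∷ 1≤v) ∣a∣≢m) ⟩
    ∑ W (λ v → - snakeWeight n (zigzag k ++ a ∷ v))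
      ≡⟨ ∑-neg W _ ⟩
    - S a ∎)

  only-±m : ∀ a → 1 ≤ ∣ a ∣ → S a ≡ (if ⌊ ∣ a ∣ ℕ.≟ m ⌋ then S a else 0ℤ)
  only-±m a 1≤a with ∣ a ∣ ℕ.≟ m
  ... | yes _    = refl
  ... | no ∣a∣≢m = S-other a 1≤a ∣a∣≢m

  S-wrong : S (wrongEntry m) ≡ 0ℤ
  S-wrong = trans (∑-cong W (λ v → snakeWeight-nonSnake n (zigzag k ++ wrongEntry m ∷ v)
                                                         (isSnakeB-zigzag-wrongEntry k v)))
                  (∑-zero W)

  zigzag-snoc : ∀ v → snakeWeight n (zigzag k ++ zigzagEntry m ∷ v) ≡ snakeWeight n (zigzag m ++ v)
  zigzag-snoc v = cong (snakeWeight n) (sym (ListP.++-assoc (zigzag k) (zigzagEntry m ∷ []) v))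

∑-zigzag-completions : ∀ n r k → k ℕ.+ r ≡ n →
  ∑ (words r (letters n)) (λ v → snakeWeight n (zigzag k ++ v)) ≡ snakeWeight n (zigzag n)
∑-zigzag-completions n zero    k k+0≡n rewrite ℕP.+-identityʳ k | k+0≡n =
  trans (ℤP.+-identityʳ _) (cong (snakeWeight n) (ListP.++-identityʳ (zigzag n)))
∑-zigzag-completions n (suc r) k k+1+r≡n =
  trans (∑-zigzag-extend n k r (subst (suc k ≤_) k+1+r≡n (ℕP.m<m+n k (s≤s z≤n))))
        (∑-zigzag-completions n r (suc k) (trans (sym (ℕP.+-suc k r)) k+1+r≡n))

snakeWeight-zigzag : ∀ n → snakeWeight n (zigzag n) ≡ sign (isEven ⌊ n /2⌋)
snakeWeight-zigzag n rewrite isSignedPerm-zigzag n | isSnakeB-zigzag n = cong sign (isEven-invB-zigzag n)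

isEven-⌊/2⌋-mod4 : ∀ n → (n % 4 ≡ 0 ⊎ n % 4 ≡ 1 → isEven ⌊ n /2⌋ ≡ true)
                       × (n % 4 ≡ 2 ⊎ n % 4 ≡ 3 → isEven ⌊ n /2⌋ ≡ false)
isEven-⌊/2⌋-mod4 0 = (λ _ → refl) , λ { (inj₁ ()) ; (inj₂ ()) }
isEven-⌊/2⌋-mod4 1 = (λ _ → refl) , λ { (inj₁ ()) ; (inj₂ ()) }
isEven-⌊/2⌋-mod4 2 = (λ { (inj₁ ()) ; (inj₂ ()) }) , λ _ → refl
isEven-⌊/2⌋-mod4 3 = (λ { (inj₁ ()) ; (inj₂ ()) }) , λ _ → refl
isEven-⌊/2⌋-mod4 (suc (suc (suc (suc n))))
  rewrite trans (cong (_% 4) (ℕP.+-comm 4 n)) ([m+n]%n≡m%n n 4) | BoolP.not-involutive (isEven ⌊ n /2⌋) =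
  isEven-⌊/2⌋-mod4 n

lemma64 : (n : ℕ) → n ≥ 1 →
    ((n % 4 ≡ 0 ⊎ n % 4 ≡ 1) → (+ SB⁺ n) - (+ SB⁻ n) ≡ + 1) × ((n % 4 ≡ 2 ⊎ n % 4 ≡ 3) → (+ SB⁺ n) - (+ SB⁻ n) ≡ - (+ 1))
lemma64 n _ = (λ r → trans signed-count (cong sign (proj₁ (isEven-⌊/2⌋-mod4 n) r)))
            , (λ r → trans signed-count (cong sign (proj₂ (isEven-⌊/2⌋-mod4 n) r)))
  where
  open ≡-Reasoning
  signed-count : + SB⁺ n - + SB⁻ n ≡ sign (isEven ⌊ n /2⌋)
  signed-count = begin
    + SB⁺ n - + SB⁻ n                          ≡⟨ signedSnakeCount n ⟩
    ∑ (words n (letters n)) (snakeWeight n)    ≡⟨ ∑-zigzag-completions n n 0 refl ⟩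
    snakeWeight n (zigzag n)                   ≡⟨ snakeWeight-zigzag n ⟩
    sign (isEven ⌊ n /2⌋)                      ∎
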